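{- For rooted trees $t_1,t_2$, $$(\mathfrak N(t_1),\mathfrak N(t_2))-(\mathfrak P(t_1),\mathfrak P(t_2))=\begin{cases}0,&\text{if }t_1\neq t_2,\\ |t|\,|SG(t)|,&\text{if }t_1=t_2=t.\end{cases}$$
   Context: A rooted tree is a finite partially ordered set (elements called vertices) with a unique greatest element, the root, such that for every vertex $v$ the set of vertices greater than $v$ is a chain; if $v$ covers $w$, $w$ is a child of $v$. We regard it as a directed graph with edges from each vertex to its children; a vertex is terminal if it has no children. Rooted trees are considered up to isomorphism; $\mathcal T$ is the set of finite rooted trees, $|t|$ the number of vertices, $\bullet$ the one-vertex tree. Write $t\lhd t'$ if $t$ is obtained from $t'$ by deleting one terminal non-root vertex and the edge into it. For $t\lhd t'$, $n(t;t')$ is the number of vertices of $t$ at which attaching a new edge to a new terminal vertex yields $t'$, and $m(t;t')$ is the number of edges of $t'$ whose removal (with their terminal endpoint) leaves $t$. For a vertex $v$ of $t$, $t_v$ is the rooted tree of $v$ and its descendants; if $v$ has children $v_1,\dots,v_k$, $SG(t,v)$ is the group generated by the exchanges of $t_{v_i}$ with $t_{v_j}$ whenever these are isomorphic; $SG(t)=\prod_v SG(t,v)$. Let $k$ be a field of characteristic $0$ and $k\{\mathcal T\}$ the vector space with basis $\mathcal T$. Growth operator: linear map $\mathfrak N(t)=\sum_{t\lhd t'}n(t;t')t'$; pruning operator: linear map $\mathfrak P(t)=\sum_{t'\lhd t}m(t';t)t'$ for $t\ne\bullet$, $\mathfrak P(\bullet)=0$. Inner product: the bilinear form with $(t,t')=|SG(t)|\delta_{t,t'}$.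 -}

module Defs where

open import Level using (Level; _⊔_) renaming (suc to lsuc)
open import Data.Nat using (ℕ; zero; suc; _!)
import Data.Nat as ℕ
open import Data.List using (List; []; _∷_; map; _++_; deduplicate; length)
open import Data.List.Relation.Binary.Pointwise using (Pointwise)
open import Data.List.Relation.Binary.Permutation.Propositional using (_↭_)
open import Data.Product using (Σ; ∃; _×_; _,_)
open import Relation.Nullary using (¬_; yes; no)
open import Relation.Binary using (Decidable)
open import Relation.Binary.PropositionalEquality using (_≡_)
open import Algebra.Bundles using (CommutativeRing)
import Algebra.Definitions.RawMonoid as RawMonoidDefs

-- The order of the list carries no
-- meaning: trees are considered up to isomorphism  _≅_  below.

data Tree : Set where
  node : List Tree → Tree

• : Tree
• = node []

-- Isomorphism of rooted trees: a root-preserving isomorphism is a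
-- bijection between the children of the two roots under which the
-- corresponding subtrees are isomorphic.
data _≅_ : Tree → Tree → Set where
  node : ∀ {ts ss} (us : List Tree) →
         Pointwise _≅_ ts us → us ↭ ss → node ts ≅ node ss

mutual
  size : Tree → ℕ
  size (node ts) = suc (sizes ts)

  sizes : List Tree → ℕ
  sizes []       = zero
  sizes (t ∷ ts) = size t ℕ.+ sizes ts

-- Trees obtained by attaching a new terminal vertex at each vertex of t
-- (one list entry per vertex of t).

mutual
  grafts : Tree → List Tree
  grafts (node ts) = node (• ∷ ts) ∷ map node (graftsChildren ts)

  graftsChildren : List Tree → List (List Tree)
  graftsChildren []       = []
  graftsChildren (t ∷ ts) =
    map (_∷ ts) (grafts t) ++ map (t ∷_) (graftsChildren ts)

-- Trees obtained by deleting one terminal non-root vertex of t together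
-- with the edge into it (one list entry per such edge of t).

isLeafList : Tree → List (List Tree) → List (List Tree)
isLeafList (node [])      ts = ts
isLeafList (node (_ ∷ _)) _  = []

mutual
  prunes : Tree → List Tree
  prunes (node ts) = map node (prunesChildren ts)

  prunesChildren : List Tree → List (List Tree)
  prunesChildren []       = []
  prunesChildren (t ∷ ts) =
    isLeafList t (ts ∷ []) ++ map (_∷ ts) (prunes t) ++ map (t ∷_) (prunesChildren ts)

record Field (c ℓ : Level) : Set (lsuc (c ⊔ ℓ)) where
  field
    commutativeRing : CommutativeRing c ℓ
  open CommutativeRing commutativeRing public
  field
    1≉0     : ¬ (1# ≈ 0#)
    inverse : ∀ x → ¬ (x ≈ 0#) → ∃ λ y → (x * y) ≈ 1#
  open RawMonoidDefs +-rawMonoid public using () renaming (_×_ to _·_)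

CharacteristicZero : ∀ {c ℓ} → Field c ℓ → Set ℓ
CharacteristicZero K = ∀ n → (n · 1#) ≈ 0# → n ≡ 0
  where open Field K

-- Everything below uses a decision procedure for isomorphism (needed to
-- compute Kronecker deltas / multiplicities); the results do not depend
-- on which decision procedure is chosen.

module Operators {c ℓ} (K : Field c ℓ) (_≅?_ : Decidable _≅_) where
  open Field K hiding (zero)

  countIso : Tree → List Tree → ℕ
  countIso t []       = ℕ.zero
  countIso t (u ∷ us) with u ≅? t
  ... | yes _ = suc (countIso t us)
  ... | no  _ = countIso t us

  classes : List Tree → List Tree
  classes = deduplicate _≅?_

  -- |SG(t,v)| for v with children subtrees ts: SG(t,v) is generated by
  -- the exchanges of isomorphic subtrees, i.e. it is the product over
  -- isomorphism classes of the symmetric groups on the children in the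
  -- class; its order is the product of the factorials of multiplicities.
  localSymmetry : List Tree → ℕ
  localSymmetry ts = prodClasses (classes ts)
    where
      prodClasses : List Tree → ℕ
      prodClasses []       = 1
      prodClasses (u ∷ us) = (countIso u ts) ! ℕ.* prodClasses us

  mutual
    |SG| : Tree → ℕ
    |SG| (node ts) = localSymmetry ts ℕ.* |SG|s ts

    |SG|s : List Tree → ℕ
    |SG|s []       = 1
    |SG|s (t ∷ ts) = |SG| t ℕ.* |SG|s ts

  nCoef : Tree → Tree → ℕ
  nCoef t t′ = countIso t′ (grafts t)

  mCoef : Tree → Tree → ℕ
  mCoef t t′ = countIso t (prunes t′)

  -- k{T}: formal finite k-linear combinations of rooted trees
  -- (Σ aᵢ tᵢ represented by the list of pairs (aᵢ , tᵢ)).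
  Vec : Set c
  Vec = List (Carrier × Tree)

  𝔑 : Tree → Vec
  𝔑 t = map (λ t′ → (nCoef t t′ · 1# , t′)) (classes (grafts t))

  𝔓 : Tree → Vec
  𝔓 (node []) = []
  𝔓 t = map (λ t′ → (mCoef t′ t · 1# , t′)) (classes (prunes t))

  ⟪_,_⟫ : Tree → Tree → Carrier
  ⟪ t , s ⟫ with t ≅? s
  ... | yes _ = |SG| t · 1#
  ... | no  _ = 0#

  innerR : Carrier → Tree → Vec → Carrier
  innerR a t []             = 0#
  innerR a t ((b , s) ∷ ys) = ((a * b) * ⟪ t , s ⟫) + innerR a t ys

  ⟨_,_⟩ : Vec → Vec → Carrier
  ⟨ [] , ys ⟩            = 0#
  ⟨ (a , t) ∷ xs , ys ⟩ = innerR a t ys + ⟨ xs , ys ⟩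

  _−_ : Carrier → Carrier → Carrier
  x − y = x + (- y)

{-# OPTIONS --safe #-}
module Submission where

-- Let #iso t s be the number of isomorphisms from t onto s: it is |SG(t)| if t ≅ s and 0
-- otherwise, so (t , s) = #iso t s · 1 and the claim becomes an identity in ℕ between the
-- sums of #iso over grafts t₁ × grafts t₂ and over prunes t₁ × prunes t₂.
-- Grafting and pruning are adjoint: Σ_{t′ ∈ grafts s} #iso t t′ and Σ_{p ∈ prunes t} #iso p s
-- both count the pairs (terminal vertex v of t, isomorphism from t − v onto s).
-- Pruning after grafting is grafting after pruning plus |t| copies of t, one for each vertex
-- at which the removed vertex had just been attached.
-- Moving the grafts of t₂ to the left as prunes, commuting, and moving them back gives
--   Σ_{grafts × grafts} #iso = |t₁| · #iso t₁ t₂ + Σ_{prunes × prunes} #iso.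

open import Defs
open import Level using (Level)
import Data.Nat as ℕ
open import Data.Nat using (ℕ; suc; _+_; _*_; _!; _≟_)
open import Data.Nat.Properties
open import Data.Nat.ListAction using (sum; product)
open import Data.Nat.ListAction.Properties using (sum-++)
open import Data.Nat.Tactic.RingSolver using (solve-∀)
open import Data.List using (List; []; _∷_; map; _++_)
open import Data.List.Properties using (map-cong; map-cong-local; map-++; map-∘)
open import Data.List.Membership.Propositional using (_∈_)
open import Data.List.Membership.Propositional.Properties using (∈-map⁻)
open import Data.List.Relation.Binary.Permutation.Propositional.Properties using (¬x∷xs↭[])
open import Data.List.Relation.Binary.Pointwise using (Pointwise; []; _∷_)
open import Data.List.Relation.Binary.Permutation.Propositional
  using (_↭_; ↭-sym; ↭-refl; ↭-trans; prep; swap; ↭-prep; ↭-swap)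
open import Data.List.Relation.Unary.Any as Any using (here; there)
open import Data.List.Relation.Unary.All as All using (All; []; _∷_)
open import Data.List.Relation.Unary.Unique.DecSetoid.Properties using (deduplicate-!)
open import Data.List.Membership.Setoid.Properties using (∈-deduplicate⁺)
open import Data.Product using (∃; _×_; _,_; proj₁; uncurry; map₂)
open import Data.Empty using (⊥-elim)
open import Function using (_∘_)
import Relation.Binary.Reasoning.Setoid as ≈-Reasoning
open import Relation.Binary.PropositionalEquality
  using (_≡_; refl; sym; trans; cong; cong₂; module ≡-Reasoning)
open import Relation.Nullary using (¬_; yes; no)
open import Relation.Binary using (Decidable; IsEquivalence; Setoid; DecSetoid)

private
  variable
    ℓ ℓ′ : Level
    A B : Set ℓ

import Algebra.Properties.CommutativeSemigroup
open import Algebra.Properties.CommutativeSemigroup +-commutativeSemigroup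
  using (interchange; x∙yz≈y∙xz)
module *-CS = Algebra.Properties.CommutativeSemigroup *-commutativeSemigroup

∑ : (A → ℕ) → List A → ℕ
∑ f xs = sum (map f xs)

∑-cong : {f g : A → ℕ} → (∀ x → f x ≡ g x) → ∀ xs → ∑ f xs ≡ ∑ g xs
∑-cong f≗g xs = cong sum (map-cong f≗g xs)

∑-cong-All : {f g : A → ℕ} {xs : List A} → All (λ x → f x ≡ g x) xs → ∑ f xs ≡ ∑ g xs
∑-cong-All f≗g = cong sum (map-cong-local f≗g)

∑-++ : (f : A → ℕ) (xs ys : List A) → ∑ f (xs ++ ys) ≡ ∑ f xs + ∑ f ys
∑-++ f xs ys = trans (cong sum (map-++ f xs ys)) (sum-++ (map f xs) (map f ys))

∑-map : (f : A → ℕ) (g : B → A) (xs : List B) → ∑ f (map g xs) ≡ ∑ (f ∘ g) xs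
∑-map f g xs = cong sum (sym (map-∘ xs))

∑-zero : (xs : List A) → ∑ (λ _ → 0) xs ≡ 0
∑-zero []       = refl
∑-zero (_ ∷ xs) = ∑-zero xs

∑-+ : (f g : A → ℕ) (xs : List A) → ∑ (λ x → f x + g x) xs ≡ ∑ f xs + ∑ g xs
∑-+ f g []       = refl
∑-+ f g (x ∷ xs) = trans (cong (f x + g x +_) (∑-+ f g xs)) (interchange (f x) (g x) _ _)

∑-*ˡ : (c : ℕ) (f : A → ℕ) (xs : List A) → ∑ (λ x → c * f x) xs ≡ c * ∑ f xs
∑-*ˡ c f []       = sym (*-zeroʳ c)
∑-*ˡ c f (x ∷ xs) = trans (cong (c * f x +_) (∑-*ˡ c f xs)) (sym (*-distribˡ-+ c (f x) _))

∑-*ʳ : (c : ℕ) (f : A → ℕ) (xs : List A) → ∑ (λ x → f x * c) xs ≡ ∑ f xs * c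
∑-*ʳ c f xs = trans (∑-cong (λ x → *-comm (f x) c) xs) (trans (∑-*ˡ c f xs) (*-comm c _))

∑-comm : (f : A → B → ℕ) (xs : List A) (ys : List B) →
         ∑ (λ x → ∑ (f x) ys) xs ≡ ∑ (λ y → ∑ (λ x → f x y) xs) ys
∑-comm f []       ys = sym (∑-zero ys)
∑-comm f (x ∷ xs) ys =
  trans (cong (∑ (f x) ys +_) (∑-comm f xs ys)) (sym (∑-+ (f x) _ ys))

∑≢0⇒∃ : (f : A → ℕ) (xs : List A) → ¬ ∑ f xs ≡ 0 → ∃ λ x → x ∈ xs × ¬ f x ≡ 0
∑≢0⇒∃ f []       ∑≢0 = ⊥-elim (∑≢0 refl)
∑≢0⇒∃ f (x ∷ xs) ∑≢0 with f x ≟ 0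
... | no  fx≢0 = x , here refl , fx≢0
... | yes fx≡0 with ∑≢0⇒∃ f xs (λ ∑≡0 → ∑≢0 (cong₂ _+_ fx≡0 ∑≡0))
...   | y , y∈xs , fy≢0 = y , there y∈xs , fy≢0

∏ : (A → ℕ) → List A → ℕ
∏ f xs = product (map f xs)

∏-cong-All : {f g : A → ℕ} {xs : List A} → All (λ x → f x ≡ g x) xs → ∏ f xs ≡ ∏ g xs
∏-cong-All f≗g = cong product (map-cong-local f≗g)

∏-unique : (f : A → ℕ) (P : List A → ℕ) → P [] ≡ 1 → (∀ x xs → P (x ∷ xs) ≡ f x * P xs) →
           ∀ xs → P xs ≡ ∏ f xs
∏-unique f P P[]≡1 P-∷ []       = P[]≡1
∏-unique f P P[]≡1 P-∷ (x ∷ xs) = trans (P-∷ x xs) (cong (f x *_) (∏-unique f P P[]≡1 P-∷ xs))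

∏-const-1 : (xs : List A) → ∏ (λ _ → 1) xs ≡ 1
∏-const-1 []       = refl
∏-const-1 (_ ∷ xs) = trans (+-identityʳ _) (∏-const-1 xs)

picks : List A → List (A × List A)
picks []       = []
picks (x ∷ xs) = (x , xs) ∷ map (map₂ (x ∷_)) (picks xs)

∑picks : (A → List A → ℕ) → List A → ℕ
∑picks Φ xs = ∑ (uncurry Φ) (picks xs)

∑picks-∷ : (Φ : A → List A → ℕ) (x : A) (xs : List A) →
           ∑picks Φ (x ∷ xs) ≡ Φ x xs + ∑picks (λ y ys → Φ y (x ∷ ys)) xs
∑picks-∷ Φ x xs = cong (Φ x xs +_) (∑-map (uncurry Φ) (map₂ (x ∷_)) (picks xs))

picks-↭ : {y : A} {ys xs : List A} → (y , ys) ∈ picks xs → xs ↭ y ∷ ys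
picks-↭ {xs = x ∷ xs} (here refl) = ↭-refl
picks-↭ {xs = x ∷ xs} (there p) with ∈-map⁻ (map₂ (x ∷_)) p
... | (z , zs) , z,zs∈picks , refl = ↭-trans (↭-prep x (picks-↭ z,zs∈picks)) (↭-swap x z ↭-refl)

map-proj₁-picks : (xs : List A) → map proj₁ (picks xs) ≡ xs
map-proj₁-picks []       = refl
map-proj₁-picks (x ∷ xs) =
  cong (x ∷_) (trans (sym (map-∘ (picks xs))) (map-proj₁-picks xs))

∑picks-proj₁ : (Φ : A → List A → ℕ) (g : A → ℕ) (xs : List A) →
               (∀ {y ys} → (y , ys) ∈ picks xs → Φ y ys ≡ g y) → ∑picks Φ xs ≡ ∑ g xs
∑picks-proj₁ Φ g xs Φ≡g = begin
  ∑ (uncurry Φ) (picks xs)       ≡⟨ ∑-cong-All (All.tabulate Φ≡g) ⟩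
  ∑ (g ∘ proj₁) (picks xs)       ≡⟨ ∑-map g proj₁ (picks xs) ⟨
  ∑ g (map proj₁ (picks xs))     ≡⟨ cong (∑ g) (map-proj₁-picks xs) ⟩
  ∑ g xs                         ∎
  where open ≡-Reasoning

∑picks-↭ : {Φ : A → List A → ℕ} → (∀ y {ys zs} → ys ↭ zs → Φ y ys ≡ Φ y zs) →
           ∀ {xs xs′} → xs ↭ xs′ → ∑picks Φ xs ≡ ∑picks Φ xs′
∑picks-↭ Φ-resp _↭_.refl = refl
∑picks-↭ {Φ = Φ} Φ-resp {x ∷ xs} {x ∷ xs′} (prep x p) = begin
  ∑picks Φ (x ∷ xs)
    ≡⟨ ∑picks-∷ Φ x xs ⟩
  Φ x xs + ∑picks (λ y ys → Φ y (x ∷ ys)) xs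
    ≡⟨ cong₂ _+_ (Φ-resp x p) (∑picks-↭ (λ y q → Φ-resp y (prep x q)) p) ⟩
  Φ x xs′ + ∑picks (λ y ys → Φ y (x ∷ ys)) xs′
    ≡⟨ ∑picks-∷ Φ x xs′ ⟨
  ∑picks Φ (x ∷ xs′) ∎
  where open ≡-Reasoning
∑picks-↭ {Φ = Φ} Φ-resp {x ∷ y ∷ xs} {y ∷ x ∷ xs′} (swap x y p) = begin
  ∑picks Φ (x ∷ y ∷ xs)
    ≡⟨ ∑picks-∷∷ x y xs ⟩
  Φ x (y ∷ xs) + (Φ y (x ∷ xs) + ∑picks (λ z zs → Φ z (x ∷ y ∷ zs)) xs)
    ≡⟨ cong₂ (λ u v → u + (v + ∑picks (λ z zs → Φ z (x ∷ y ∷ zs)) xs))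
             (Φ-resp x (prep y p)) (Φ-resp y (prep x p)) ⟩
  Φ x (y ∷ xs′) + (Φ y (x ∷ xs′) + ∑picks (λ z zs → Φ z (x ∷ y ∷ zs)) xs)
    ≡⟨ cong (λ u → Φ x (y ∷ xs′) + (Φ y (x ∷ xs′) + u)) rest-↭ ⟩
  Φ x (y ∷ xs′) + (Φ y (x ∷ xs′) + ∑picks (λ z zs → Φ z (y ∷ x ∷ zs)) xs′)
    ≡⟨ x∙yz≈y∙xz (Φ x (y ∷ xs′)) (Φ y (x ∷ xs′)) _ ⟩
  Φ y (x ∷ xs′) + (Φ x (y ∷ xs′) + ∑picks (λ z zs → Φ z (y ∷ x ∷ zs)) xs′)
    ≡⟨ ∑picks-∷∷ y x xs′ ⟨
  ∑picks Φ (y ∷ x ∷ xs′) ∎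
  where
  open ≡-Reasoning
  ∑picks-∷∷ : ∀ x y xs → ∑picks Φ (x ∷ y ∷ xs) ≡
              Φ x (y ∷ xs) + (Φ y (x ∷ xs) + ∑picks (λ z zs → Φ z (x ∷ y ∷ zs)) xs)
  ∑picks-∷∷ x y xs = trans (∑picks-∷ Φ x (y ∷ xs)) (cong (Φ x (y ∷ xs) +_) (∑picks-∷ _ y xs))
  rest-↭ : ∑picks (λ z zs → Φ z (x ∷ y ∷ zs)) xs ≡ ∑picks (λ z zs → Φ z (y ∷ x ∷ zs)) xs′
  rest-↭ = trans (∑picks-↭ (λ z q → Φ-resp z (prep x (prep y q))) p)
                 (∑-cong (λ (z , zs) → Φ-resp z (↭-swap x y ↭-refl)) (picks xs′))
∑picks-↭ Φ-resp (_↭_.trans p q) = trans (∑picks-↭ Φ-resp p) (∑picks-↭ Φ-resp q)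

∑picks-swap : (Ψ : A → A → List A → ℕ) (xs : List A) →
              ∑picks (λ y ys → ∑picks (Ψ y) ys) xs ≡ ∑picks (λ y ys → ∑picks (λ z → Ψ z y) ys) xs
∑picks-swap Ψ []       = refl
∑picks-swap Ψ (x ∷ xs) = begin
  ∑picks (λ y ys → ∑picks (Ψ y) ys) (x ∷ xs)
    ≡⟨ ∑picks-∷ _ x xs ⟩
  a + ∑picks (λ y ys → ∑picks (Ψ y) (x ∷ ys)) xs
    ≡⟨ cong (a +_) (trans (∑-cong (λ (y , ys) → ∑picks-∷ (Ψ y) x ys) (picks xs)) (∑-+ _ _ (picks xs))) ⟩
  a + (b + ∑picks (λ y ys → ∑picks (λ z zs → Ψ y z (x ∷ zs)) ys) xs)
    ≡⟨ cong (λ u → a + (b + u)) (∑picks-swap (λ y z zs → Ψ y z (x ∷ zs)) xs) ⟩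
  a + (b + ∑picks (λ y ys → ∑picks (λ z zs → Ψ z y (x ∷ zs)) ys) xs)
    ≡⟨ x∙yz≈y∙xz a b _ ⟩
  b + (a + ∑picks (λ y ys → ∑picks (λ z zs → Ψ z y (x ∷ zs)) ys) xs)
    ≡⟨ cong (b +_) (trans (∑-cong (λ (y , ys) → ∑picks-∷ (λ z → Ψ z y) x ys) (picks xs)) (∑-+ _ _ (picks xs))) ⟨
  b + ∑picks (λ y ys → ∑picks (λ z → Ψ z y) (x ∷ ys)) xs
    ≡⟨ ∑picks-∷ _ x xs ⟨
  ∑picks (λ y ys → ∑picks (λ z → Ψ z y) ys) (x ∷ xs) ∎
  where
  open ≡-Reasoning
  a = ∑picks (Ψ x) xs
  b = ∑picks (λ y → Ψ y x) xs

∑picks-Pointwise : {_~_ : A → A → Set ℓ′} {Φ Φ′ : A → List A → ℕ} →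
                   (∀ {y y′ ys ys′} → y ~ y′ → Pointwise _~_ ys ys′ → Φ y ys ≡ Φ′ y′ ys′) →
                   ∀ {xs xs′} → Pointwise _~_ xs xs′ → ∑picks Φ xs ≡ ∑picks Φ′ xs′
∑picks-Pointwise Φ-resp [] = refl
∑picks-Pointwise {Φ = Φ} {Φ′} Φ-resp {x ∷ xs} {x′ ∷ xs′} (x~x′ ∷ xs~xs′) = begin
  ∑picks Φ (x ∷ xs)                              ≡⟨ ∑picks-∷ Φ x xs ⟩
  Φ x xs + ∑picks (λ y ys → Φ y (x ∷ ys)) xs     ≡⟨ cong₂ _+_ (Φ-resp x~x′ xs~xs′) rest ⟩
  Φ′ x′ xs′ + ∑picks (λ y ys → Φ′ y (x′ ∷ ys)) xs′ ≡⟨ ∑picks-∷ Φ′ x′ xs′ ⟨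
  ∑picks Φ′ (x′ ∷ xs′)                           ∎
  where
  open ≡-Reasoning
  rest = ∑picks-Pointwise (λ y~y′ ys~ys′ → Φ-resp y~y′ (x~x′ ∷ ys~ys′)) xs~xs′

_≋_ : List Tree → List Tree → Set
_≋_ = Pointwise _≅_

↭-≋⇒≋-↭ : ∀ {xs ys zs} → xs ↭ ys → ys ≋ zs → ∃ λ ys′ → xs ≋ ys′ × ys′ ↭ zs
↭-≋⇒≋-↭ _↭_.refl ys≋zs = _ , ys≋zs , ↭-refl
↭-≋⇒≋-↭ (prep x p) (x≅z ∷ ys≋zs) with ↭-≋⇒≋-↭ p ys≋zs
... | _ , ≋ , ↭ = _ , x≅z ∷ ≋ , prep _ ↭
↭-≋⇒≋-↭ (swap x y p) (y≅z ∷ x≅z′ ∷ ys≋zs) with ↭-≋⇒≋-↭ p ys≋zs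
... | _ , ≋ , ↭ = _ , x≅z′ ∷ y≅z ∷ ≋ , swap _ _ ↭
↭-≋⇒≋-↭ (_↭_.trans p q) ys≋zs with ↭-≋⇒≋-↭ q ys≋zs
... | _ , ≋₁ , ↭₁ with ↭-≋⇒≋-↭ p ≋₁
...   | _ , ≋₂ , ↭₂ = _ , ≋₂ , ↭-trans ↭₂ ↭₁

mutual
  ≅-refl : ∀ {t} → t ≅ t
  ≅-refl {node ts} = node ts ≋-refl ↭-refl

  ≋-refl : ∀ {ts} → ts ≋ ts
  ≋-refl {[]}     = []
  ≋-refl {t ∷ ts} = ≅-refl ∷ ≋-refl

mutual
  ≅-sym : ∀ {t s} → t ≅ s → s ≅ t
  ≅-sym (node _ ts≋us us↭ss) with ↭-≋⇒≋-↭ (↭-sym us↭ss) (≋-sym ts≋us)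
  ... | _ , ss≋vs , vs↭ts = node _ ss≋vs vs↭ts

  ≋-sym : ∀ {ts us} → ts ≋ us → us ≋ ts
  ≋-sym []              = []
  ≋-sym (t≅u ∷ ts≋us) = ≅-sym t≅u ∷ ≋-sym ts≋us

mutual
  ≅-trans : ∀ {t s r} → t ≅ s → s ≅ r → t ≅ r
  ≅-trans (node _ ts≋us us↭ss) (node _ ss≋vs vs↭rs) with ↭-≋⇒≋-↭ us↭ss ss≋vs
  ... | _ , us≋ws , ws↭vs = node _ (≋-trans ts≋us us≋ws) (↭-trans ws↭vs vs↭rs)

  ≋-trans : ∀ {ts us vs} → ts ≋ us → us ≋ vs → ts ≋ vs
  ≋-trans []              []              = []
  ≋-trans (t≅u ∷ ts≋us) (u≅v ∷ us≋vs) = ≅-trans t≅u u≅v ∷ ≋-trans ts≋us us≋vs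

≅-∷ : ∀ {t s ts ss} → t ≅ s → node ts ≅ node ss → node (t ∷ ts) ≅ node (s ∷ ss)
≅-∷ {s = s} t≅s (node us ts≋us us↭ss) = node (s ∷ us) (t≅s ∷ ts≋us) (prep s us↭ss)

↭⇒≅ : ∀ {ts ss} → ts ↭ ss → node ts ≅ node ss
↭⇒≅ ts↭ss = node _ ≋-refl ts↭ss

≅-isEquivalence : IsEquivalence _≅_
≅-isEquivalence = record { refl = ≅-refl ; sym = ≅-sym ; trans = ≅-trans }

≅-setoid : Setoid _ _
≅-setoid = record { isEquivalence = ≅-isEquivalence }

open import Data.List.Membership.Setoid ≅-setoid using () renaming (_∈_ to _∈≅_)
open import Data.List.Relation.Unary.Unique.Setoid ≅-setoid using (Unique; []; _∷_)

≅-All-≇ : ∀ {x a C} → x ≅ a → All (λ b → ¬ a ≅ b) C → All (λ b → ¬ x ≅ b) C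
≅-All-≇ x≅a = All.map (λ a≇b x≅b → a≇b (≅-trans (≅-sym x≅a) x≅b))

∈≅-All-≇ : ∀ {x a C} → x ∈≅ C → All (λ b → ¬ a ≅ b) C → ¬ x ≅ a
∈≅-All-≇ (here x≅b)  (a≇b ∷ _)  x≅a = a≇b (≅-trans (≅-sym x≅a) x≅b)
∈≅-All-≇ (there x∈C) (_ ∷ a≇C) x≅a = ∈≅-All-≇ x∈C a≇C x≅a

mutual
  #iso : Tree → Tree → ℕ
  #iso (node ts) (node ss) = #matchings ts ss

  #matchings : List Tree → List Tree → ℕ
  #matchings []       []      = 1
  #matchings []       (_ ∷ _) = 0
  #matchings (t ∷ ts) ss      = ∑picks (λ s rest → #iso t s * #matchings ts rest) ss

#matchings-↭ʳ : ∀ ts {ss ss′} → ss ↭ ss′ → #matchings ts ss ≡ #matchings ts ss′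
#matchings-↭ʳ []       {[]}    {[]}    _ = refl
#matchings-↭ʳ []       {[]}    {_ ∷ _} p = ⊥-elim (¬x∷xs↭[] (↭-sym p))
#matchings-↭ʳ []       {_ ∷ _} {[]}    p = ⊥-elim (¬x∷xs↭[] p)
#matchings-↭ʳ []       {_ ∷ _} {_ ∷ _} _ = refl
#matchings-↭ʳ (t ∷ ts) p = ∑picks-↭ (λ s q → cong (#iso t s *_) (#matchings-↭ʳ ts q)) p

mutual
  #iso-congʳ : ∀ t {s s′} → s ≅ s′ → #iso t s ≡ #iso t s′
  #iso-congʳ (node ts) (node _ ss≋us us↭ss′) =
    trans (#matchings-≋ʳ ts ss≋us) (#matchings-↭ʳ ts us↭ss′)

  #matchings-≋ʳ : ∀ ts {ss ss′} → ss ≋ ss′ → #matchings ts ss ≡ #matchings ts ss′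
  #matchings-≋ʳ []       []      = refl
  #matchings-≋ʳ []       (_ ∷ _) = refl
  #matchings-≋ʳ (t ∷ ts) ss≋ss′ =
    ∑picks-Pointwise (λ s≅s′ rest≋rest′ → cong₂ _*_ (#iso-congʳ t s≅s′) (#matchings-≋ʳ ts rest≋rest′)) ss≋ss′

-- Swapping the first two children swaps the order in which their images are picked.
#matchings-↭ˡ : ∀ {ts ts′} → ts ↭ ts′ → ∀ ss → #matchings ts ss ≡ #matchings ts′ ss
#matchings-↭ˡ _↭_.refl ss = refl
#matchings-↭ˡ (prep t p) ss = ∑-cong (λ (s , rest) → cong (#iso t s *_) (#matchings-↭ˡ p rest)) (picks ss)
#matchings-↭ˡ {t ∷ u ∷ ts} {u ∷ t ∷ ts′} (swap t u p) ss = begin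
  ∑picks (λ s rest → #iso t s * ∑picks (λ s′ rest′ → #iso u s′ * #matchings ts rest′) rest) ss
    ≡⟨ ∑-cong (λ (s , rest) → ∑-*ˡ (#iso t s) _ (picks rest)) (picks ss) ⟨
  ∑picks (λ s rest → ∑picks (λ s′ rest′ → #iso t s * (#iso u s′ * #matchings ts rest′)) rest) ss
    ≡⟨ ∑picks-swap (λ s s′ rest′ → #iso t s * (#iso u s′ * #matchings ts rest′)) ss ⟩
  ∑picks (λ s rest → ∑picks (λ s′ rest′ → #iso t s′ * (#iso u s * #matchings ts rest′)) rest) ss
    ≡⟨ ∑-cong (λ (s , rest) → ∑-cong (λ (s′ , rest′) → reorder s s′ rest′) (picks rest)) (picks ss) ⟩
  ∑picks (λ s rest → ∑picks (λ s′ rest′ → #iso u s * (#iso t s′ * #matchings ts′ rest′)) rest) ss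
    ≡⟨ ∑-cong (λ (s , rest) → ∑-*ˡ (#iso u s) _ (picks rest)) (picks ss) ⟩
  ∑picks (λ s rest → #iso u s * ∑picks (λ s′ rest′ → #iso t s′ * #matchings ts′ rest′) rest) ss ∎
  where
  open ≡-Reasoning
  reorder : ∀ s s′ rest → #iso t s′ * (#iso u s * #matchings ts rest) ≡ #iso u s * (#iso t s′ * #matchings ts′ rest)
  reorder s s′ rest = trans (cong (λ m → #iso t s′ * (#iso u s * m)) (#matchings-↭ˡ p rest))
                            (*-CS.x∙yz≈y∙xz (#iso t s′) (#iso u s) (#matchings ts′ rest))
#matchings-↭ˡ (_↭_.trans p q) ss = trans (#matchings-↭ˡ p ss) (#matchings-↭ˡ q ss)

mutual
  #iso-congˡ : ∀ {t t′} → t ≅ t′ → ∀ s → #iso t s ≡ #iso t′ s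
  #iso-congˡ (node _ ts≋us us↭ts′) (node ss) =
    trans (#matchings-≋ˡ ts≋us ss) (#matchings-↭ˡ us↭ts′ ss)

  #matchings-≋ˡ : ∀ {ts ts′} → ts ≋ ts′ → ∀ ss → #matchings ts ss ≡ #matchings ts′ ss
  #matchings-≋ˡ []              ss = refl
  #matchings-≋ˡ (t≅t′ ∷ ts≋ts′) ss =
    ∑-cong (λ (s , rest) → cong₂ _*_ (#iso-congˡ t≅t′ s) (#matchings-≋ˡ ts≋ts′ rest)) (picks ss)

mutual
  #iso≢0⇒≅ : ∀ t s → ¬ #iso t s ≡ 0 → t ≅ s
  #iso≢0⇒≅ (node ts) (node ss) = #matchings≢0⇒≅ ts ss

  #matchings≢0⇒≅ : ∀ ts ss → ¬ #matchings ts ss ≡ 0 → node ts ≅ node ss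
  #matchings≢0⇒≅ []       []      _  = ≅-refl
  #matchings≢0⇒≅ []       (_ ∷ _) ≢0 = ⊥-elim (≢0 refl)
  #matchings≢0⇒≅ (t ∷ ts) ss      ≢0
    with ∑≢0⇒∃ (uncurry λ s rest → #iso t s * #matchings ts rest) (picks ss) ≢0
  ... | (s , rest) , s,rest∈picks , term≢0 =
    ≅-trans (≅-∷ (#iso≢0⇒≅ t s (term≢0 ∘ left-zero)) (#matchings≢0⇒≅ ts rest (term≢0 ∘ right-zero)))
            (↭⇒≅ (↭-sym (picks-↭ s,rest∈picks)))
    where
    left-zero : #iso t s ≡ 0 → #iso t s * #matchings ts rest ≡ 0
    left-zero ≡0 = cong (_* #matchings ts rest) ≡0
    right-zero : #matchings ts rest ≡ 0 → #iso t s * #matchings ts rest ≡ 0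
    right-zero ≡0 = trans (cong (#iso t s *_) ≡0) (*-zeroʳ (#iso t s))

#iso-≇ : ∀ {t s} → ¬ t ≅ s → #iso t s ≡ 0
#iso-≇ {t} {s} t≇s with #iso t s ≟ 0
... | yes ≡0 = ≡0
... | no  ≢0 = ⊥-elim (t≇s (#iso≢0⇒≅ t s ≢0))

≅⇒#iso-sym : ∀ {t s} → t ≅ s → #iso t s ≡ #iso s t
≅⇒#iso-sym {t} t≅s = trans (#iso-congʳ t (≅-sym t≅s)) (#iso-congˡ t≅s t)

#iso-sym : ∀ t s → #iso t s ≡ #iso s t
#iso-sym t s with #iso t s ≟ 0 | #iso s t ≟ 0
... | no  ≢0 | _       = ≅⇒#iso-sym (#iso≢0⇒≅ t s ≢0)
... | _      | no  ≢0  = sym (≅⇒#iso-sym (#iso≢0⇒≅ s t ≢0))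
... | yes ≡0 | yes ≡0′ = trans ≡0 (sym ≡0′)

isLeaf : Tree → ℕ
isLeaf (node [])      = 1
isLeaf (node (_ ∷ _)) = 0

#iso-• : ∀ t → #iso t • ≡ isLeaf t
#iso-• (node [])      = refl
#iso-• (node (_ ∷ _)) = refl

∑-isLeafList : (ψ : List Tree → ℕ) (t : Tree) (ts : List Tree) →
               ∑ ψ (isLeafList t (ts ∷ [])) ≡ isLeaf t * ψ ts
∑-isLeafList ψ (node [])      ts = refl
∑-isLeafList ψ (node (_ ∷ _)) ts = refl

∑-graftsChildren-∷ : (ψ : List Tree → ℕ) (t : Tree) (ts : List Tree) →
  ∑ ψ (graftsChildren (t ∷ ts)) ≡ ∑ (λ g → ψ (g ∷ ts)) (grafts t) + ∑ (λ gs → ψ (t ∷ gs)) (graftsChildren ts)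
∑-graftsChildren-∷ ψ t ts =
  trans (∑-++ ψ (map (_∷ ts) (grafts t)) _) (cong₂ _+_ (∑-map ψ (_∷ ts) (grafts t)) (∑-map ψ (t ∷_) (graftsChildren ts)))

∑-prunesChildren-∷ : (ψ : List Tree → ℕ) (t : Tree) (ts : List Tree) →
  ∑ ψ (prunesChildren (t ∷ ts)) ≡
  isLeaf t * ψ ts + (∑ (λ p → ψ (p ∷ ts)) (prunes t) + ∑ (λ ps → ψ (t ∷ ps)) (prunesChildren ts))
∑-prunesChildren-∷ ψ t ts = begin
  ∑ ψ (prunesChildren (t ∷ ts))
    ≡⟨ ∑-++ ψ (isLeafList t (ts ∷ [])) _ ⟩
  ∑ ψ (isLeafList t (ts ∷ [])) + ∑ ψ (map (_∷ ts) (prunes t) ++ map (t ∷_) (prunesChildren ts))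
    ≡⟨ cong₂ _+_ (∑-isLeafList ψ t ts) (∑-++ ψ (map (_∷ ts) (prunes t)) _) ⟩
  isLeaf t * ψ ts + (∑ ψ (map (_∷ ts) (prunes t)) + ∑ ψ (map (t ∷_) (prunesChildren ts)))
    ≡⟨ cong (isLeaf t * ψ ts +_) (cong₂ _+_ (∑-map ψ (_∷ ts) (prunes t)) (∑-map ψ (t ∷_) (prunesChildren ts))) ⟩
  isLeaf t * ψ ts + (∑ (λ p → ψ (p ∷ ts)) (prunes t) + ∑ (λ ps → ψ (t ∷ ps)) (prunesChildren ts)) ∎
  where open ≡-Reasoning

∑-graftsChildren≡0 : (ψ : List Tree → ℕ) → (∀ t ts → ψ (t ∷ ts) ≡ 0) → ∀ ts → ∑ ψ (graftsChildren ts) ≡ 0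
∑-graftsChildren≡0 ψ ψ≡0 []       = refl
∑-graftsChildren≡0 ψ ψ≡0 (t ∷ ts) = begin
  ∑ ψ (graftsChildren (t ∷ ts))                                          ≡⟨ ∑-graftsChildren-∷ ψ t ts ⟩
  ∑ (λ g → ψ (g ∷ ts)) (grafts t) + ∑ (λ gs → ψ (t ∷ gs)) (graftsChildren ts)
    ≡⟨ cong₂ _+_ (trans (∑-cong (λ g → ψ≡0 g ts) (grafts t)) (∑-zero (grafts t)))
                 (trans (∑-cong (ψ≡0 t) (graftsChildren ts)) (∑-zero (graftsChildren ts))) ⟩
  0 ∎
  where open ≡-Reasoning

∑-isLeaf-grafts : ∀ t → ∑ isLeaf (grafts t) ≡ 0
∑-isLeaf-grafts (node ts) =
  trans (∑-map isLeaf node (graftsChildren ts)) (∑-graftsChildren≡0 (isLeaf ∘ node) (λ _ _ → refl) ts)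

∑picks-graftsChildren : (Φ : Tree → List Tree → ℕ) (ss : List Tree) →
  ∑ (∑picks Φ) (graftsChildren ss) ≡
  ∑picks (λ s rest → ∑ (λ g → Φ g rest) (grafts s) + ∑ (Φ s) (graftsChildren rest)) ss
∑picks-graftsChildren Φ []       = refl
∑picks-graftsChildren Φ (s ∷ ss) = begin
  ∑ (∑picks Φ) (graftsChildren (s ∷ ss))
    ≡⟨ ∑-graftsChildren-∷ (∑picks Φ) s ss ⟩
  ∑ (λ g → ∑picks Φ (g ∷ ss)) (grafts s) + ∑ (λ gs → ∑picks Φ (s ∷ gs)) (graftsChildren ss)
    ≡⟨ cong₂ _+_ (trans (∑-cong (λ g → ∑picks-∷ Φ g ss) (grafts s)) (∑-+ _ _ (grafts s)))
                 (trans (∑-cong (∑picks-∷ Φ s) (graftsChildren ss)) (∑-+ _ _ (graftsChildren ss))) ⟩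
  (a + ∑ (λ g → ∑picks (λ t rest → Φ t (g ∷ rest)) ss) (grafts s))
    + (c + ∑ (∑picks (λ t rest → Φ t (s ∷ rest))) (graftsChildren ss))
    ≡⟨ cong₂ (λ u v → (a + u) + (c + v)) (∑-comm (λ g (t , rest) → Φ t (g ∷ rest)) (grafts s) (picks ss))
                                         (∑picks-graftsChildren (λ t rest → Φ t (s ∷ rest)) ss) ⟩
  (a + ∑picks β ss) + (c + ∑picks δ ss)
    ≡⟨ interchange a (∑picks β ss) c (∑picks δ ss) ⟩
  (a + c) + (∑picks β ss + ∑picks δ ss)
    ≡⟨ cong ((a + c) +_) (trans (sym (∑-+ (uncurry β) (uncurry δ) (picks ss))) (∑-cong (uncurry β+δ≡Θ) (picks ss))) ⟩
  (a + c) + ∑picks (λ t rest → Θ t (s ∷ rest)) ss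
    ≡⟨ ∑picks-∷ Θ s ss ⟨
  ∑picks Θ (s ∷ ss) ∎
  where
  open ≡-Reasoning
  Θ β δ : Tree → List Tree → ℕ
  Θ t rest = ∑ (λ g → Φ g rest) (grafts t) + ∑ (Φ t) (graftsChildren rest)
  β t rest = ∑ (λ g → Φ t (g ∷ rest)) (grafts s)
  δ t rest = ∑ (λ g → Φ g (s ∷ rest)) (grafts t) + ∑ (λ gs → Φ t (s ∷ gs)) (graftsChildren rest)
  a = ∑ (λ g → Φ g ss) (grafts s)
  c = ∑ (Φ s) (graftsChildren ss)

  β+δ≡Θ : ∀ t rest → β t rest + δ t rest ≡ Θ t (s ∷ rest)
  β+δ≡Θ t rest = trans (x∙yz≈y∙xz (β t rest) (∑ (λ g → Φ g (s ∷ rest)) (grafts t)) _)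
                       (cong (∑ (λ g → Φ g (s ∷ rest)) (grafts t) +_) (sym (∑-graftsChildren-∷ (Φ t) s rest)))

mutual
  grafts⊣prunes : ∀ t s → ∑ (#iso t) (grafts s) ≡ ∑ (λ p → #iso p s) (prunes t)
  grafts⊣prunes (node ts) (node ss) = begin
    #matchings ts (• ∷ ss) + ∑ (#iso (node ts)) (map node (graftsChildren ss))
      ≡⟨ cong (#matchings ts (• ∷ ss) +_) (∑-map (#iso (node ts)) node (graftsChildren ss)) ⟩
    #matchings ts (• ∷ ss) + ∑ (#matchings ts) (graftsChildren ss)
      ≡⟨ graftsChildren⊣prunesChildren ts ss ⟩
    ∑ (λ ps → #matchings ps ss) (prunesChildren ts)
      ≡⟨ ∑-map (λ p → #iso p (node ss)) node (prunesChildren ts) ⟨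
    ∑ (λ p → #iso p (node ss)) (map node (prunesChildren ts)) ∎
    where open ≡-Reasoning

  graftsChildren⊣prunesChildren : ∀ ts ss →
    #matchings ts (• ∷ ss) + ∑ (#matchings ts) (graftsChildren ss) ≡ ∑ (λ ps → #matchings ps ss) (prunesChildren ts)
  graftsChildren⊣prunesChildren []       ss = ∑-graftsChildren≡0 (#matchings []) (λ _ _ → refl) ss
  graftsChildren⊣prunesChildren (t ∷ ts) ss = begin
    ∑picks Φ (• ∷ ss) + ∑ (∑picks Φ) (graftsChildren ss)
      ≡⟨ cong₂ _+_ (∑picks-∷ Φ • ss) (trans (∑picks-graftsChildren Φ ss) (∑-+ _ _ (picks ss))) ⟩
    (a + d) + (b + c)
      ≡⟨ trans (+-assoc a d (b + c)) (cong (a +_) (x∙yz≈y∙xz d b c)) ⟩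
    a + (b + (d + c))
      ≡⟨ cong₂ (λ u v → u + (v + (d + c))) leaf-term pruned-head ⟨
    isLeaf t * #matchings ts ss + (∑ (λ p → #matchings (p ∷ ts) ss) (prunes t) + (d + c))
      ≡⟨ cong (λ u → isLeaf t * #matchings ts ss + (∑ (λ p → #matchings (p ∷ ts) ss) (prunes t) + u)) pruned-tail ⟨
    isLeaf t * #matchings ts ss
      + (∑ (λ p → #matchings (p ∷ ts) ss) (prunes t) + ∑ (λ ps → #matchings (t ∷ ps) ss) (prunesChildren ts))
      ≡⟨ ∑-prunesChildren-∷ (λ ps → #matchings ps ss) t ts ⟨
    ∑ (λ ps → #matchings ps ss) (prunesChildren (t ∷ ts)) ∎
    where
    open ≡-Reasoning
    M = #matchings ts
    Φ : Tree → List Tree → ℕ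
    Φ s rest = #iso t s * M rest
    a = Φ • ss
    b = ∑picks (λ s rest → ∑ (λ g → Φ g rest) (grafts s)) ss
    c = ∑picks (λ s rest → ∑ (Φ s) (graftsChildren rest)) ss
    d = ∑picks (λ s rest → Φ s (• ∷ rest)) ss

    leaf-term : isLeaf t * M ss ≡ a
    leaf-term = cong (_* M ss) (sym (#iso-• t))

    pruned-head : ∑ (λ p → #matchings (p ∷ ts) ss) (prunes t) ≡ b
    pruned-head = begin
      ∑ (λ p → ∑picks (λ s rest → #iso p s * M rest) ss) (prunes t)
        ≡⟨ ∑-comm (λ p (s , rest) → #iso p s * M rest) (prunes t) (picks ss) ⟩
      ∑picks (λ s rest → ∑ (λ p → #iso p s * M rest) (prunes t)) ss
        ≡⟨ ∑-cong (λ (s , rest) → ∑-*ʳ (M rest) (λ p → #iso p s) (prunes t)) (picks ss) ⟩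
      ∑picks (λ s rest → ∑ (λ p → #iso p s) (prunes t) * M rest) ss
        ≡⟨ ∑-cong (λ (s , rest) → cong (_* M rest) (grafts⊣prunes t s)) (picks ss) ⟨
      ∑picks (λ s rest → ∑ (#iso t) (grafts s) * M rest) ss
        ≡⟨ ∑-cong (λ (s , rest) → ∑-*ʳ (M rest) (#iso t) (grafts s)) (picks ss) ⟨
      b ∎

    pruned-tail : ∑ (λ ps → #matchings (t ∷ ps) ss) (prunesChildren ts) ≡ d + c
    pruned-tail = begin
      ∑ (λ ps → ∑picks (λ s rest → #iso t s * #matchings ps rest) ss) (prunesChildren ts)
        ≡⟨ ∑-comm (λ ps (s , rest) → #iso t s * #matchings ps rest) (prunesChildren ts) (picks ss) ⟩
      ∑picks (λ s rest → ∑ (λ ps → #iso t s * #matchings ps rest) (prunesChildren ts)) ss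
        ≡⟨ ∑-cong (λ (s , rest) → ∑-*ˡ (#iso t s) (λ ps → #matchings ps rest) (prunesChildren ts)) (picks ss) ⟩
      ∑picks (λ s rest → #iso t s * ∑ (λ ps → #matchings ps rest) (prunesChildren ts)) ss
        ≡⟨ ∑-cong (λ (s , rest) → cong (#iso t s *_) (graftsChildren⊣prunesChildren ts rest)) (picks ss) ⟨
      ∑picks (λ s rest → #iso t s * (M (• ∷ rest) + ∑ M (graftsChildren rest))) ss
        ≡⟨ ∑-cong (λ (s , rest) → trans (*-distribˡ-+ (#iso t s) (M (• ∷ rest)) _)
                                        (cong (Φ s (• ∷ rest) +_) (sym (∑-*ˡ (#iso t s) M (graftsChildren rest)))))
                  (picks ss) ⟩
      ∑picks (λ s rest → Φ s (• ∷ rest) + ∑ (Φ s) (graftsChildren rest)) ss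
        ≡⟨ ∑-+ _ _ (picks ss) ⟩
      d + c ∎

mutual
  prunes-grafts-commute : (φ : Tree → ℕ) (t : Tree) →
    ∑ (∑ φ ∘ prunes) (grafts t) ≡ size t * φ t + ∑ (∑ φ ∘ grafts) (prunes t)
  prunes-grafts-commute φ (node ss) = begin
    (a + ∑ φ (map node (map (• ∷_) (prunesChildren ss)))) + ∑ (∑ φ ∘ prunes) (map node (graftsChildren ss))
      ≡⟨ cong₂ _+_ (cong (a +_) (trans (∑-map φ node (map (• ∷_) (prunesChildren ss)))
                                       (∑-map (φ ∘ node) (• ∷_) (prunesChildren ss))))
                   (trans (∑-map (∑ φ ∘ prunes) node (graftsChildren ss))
                          (∑-cong (λ gs → ∑-map φ node (prunesChildren gs)) (graftsChildren ss))) ⟩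
    (a + b) + ∑ (∑ (φ ∘ node) ∘ prunesChildren) (graftsChildren ss)
      ≡⟨ cong ((a + b) +_) (prunesChildren-graftsChildren-commute (φ ∘ node) ss) ⟩
    (a + b) + (sizes ss * a + d)
      ≡⟨ interchange a b (sizes ss * a) d ⟩
    (a + sizes ss * a) + (b + d)
      ≡⟨ cong ((a + sizes ss * a) +_) (∑-+ _ _ (prunesChildren ss)) ⟨
    (a + sizes ss * a) + ∑ (λ ps → φ (node (• ∷ ps)) + ∑ (φ ∘ node) (graftsChildren ps)) (prunesChildren ss)
      ≡⟨ cong ((a + sizes ss * a) +_) (trans (∑-map (∑ φ ∘ grafts) node (prunesChildren ss))
           (∑-cong (λ ps → cong (φ (node (• ∷ ps)) +_) (∑-map φ node (graftsChildren ps))) (prunesChildren ss))) ⟨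
    (a + sizes ss * a) + ∑ (∑ φ ∘ grafts) (map node (prunesChildren ss)) ∎
    where
    open ≡-Reasoning
    a = φ (node ss)
    b = ∑ (λ ps → φ (node (• ∷ ps))) (prunesChildren ss)
    d = ∑ (∑ (φ ∘ node) ∘ graftsChildren) (prunesChildren ss)

  prunesChildren-graftsChildren-commute : (ψ : List Tree → ℕ) (ss : List Tree) →
    ∑ (∑ ψ ∘ prunesChildren) (graftsChildren ss) ≡ sizes ss * ψ ss + ∑ (∑ ψ ∘ graftsChildren) (prunesChildren ss)
  prunesChildren-graftsChildren-commute ψ [] = refl
  prunesChildren-graftsChildren-commute ψ (s ∷ ss) = begin
    ∑ (∑ ψ ∘ prunesChildren) (graftsChildren (s ∷ ss))
      ≡⟨ ∑-graftsChildren-∷ (∑ ψ ∘ prunesChildren) s ss ⟩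
    ∑ (λ g → ∑ ψ (prunesChildren (g ∷ ss))) (grafts s) + ∑ (λ gs → ∑ ψ (prunesChildren (s ∷ gs))) (graftsChildren ss)
      ≡⟨ cong₂ _+_ grafted-head grafted-tail ⟩
    (c₁ + (p₁ + q₁)) + (l + (p₂ + (c₂ + q₂)))
      ≡⟨ rearrange c₁ c₂ l p₁ p₂ q₁ q₂ ⟩
    (c₁ + c₂) + (l + ((p₁ + p₂) + (q₁ + q₂)))
      ≡⟨ cong₂ _+_ (*-distribʳ-+ (ψ (s ∷ ss)) (size s) (sizes ss)) pruned-sum ⟨
    (size s + sizes ss) * ψ (s ∷ ss) + ∑ (∑ ψ ∘ graftsChildren) (prunesChildren (s ∷ ss)) ∎
    where
    open ≡-Reasoning
    c₁ = size s * ψ (s ∷ ss)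
    c₂ = sizes ss * ψ (s ∷ ss)
    l  = isLeaf s * ∑ ψ (graftsChildren ss)
    p₁ = ∑ (λ p → ∑ (λ g → ψ (g ∷ ss)) (grafts p)) (prunes s)
    p₂ = ∑ (λ p → ∑ (λ gs → ψ (p ∷ gs)) (graftsChildren ss)) (prunes s)
    q₁ = ∑ (λ ps → ∑ (λ g → ψ (g ∷ ps)) (grafts s)) (prunesChildren ss)
    q₂ = ∑ (λ ps → ∑ (λ gs → ψ (s ∷ gs)) (graftsChildren ps)) (prunesChildren ss)

    rearrange : ∀ c₁ c₂ l p₁ p₂ q₁ q₂ →
      (c₁ + (p₁ + q₁)) + (l + (p₂ + (c₂ + q₂))) ≡ (c₁ + c₂) + (l + ((p₁ + p₂) + (q₁ + q₂)))
    rearrange = solve-∀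

    grafted-head : ∑ (λ g → ∑ ψ (prunesChildren (g ∷ ss))) (grafts s) ≡ c₁ + (p₁ + q₁)
    grafted-head = begin
      ∑ (λ g → ∑ ψ (prunesChildren (g ∷ ss))) (grafts s)
        ≡⟨ ∑-cong (λ g → ∑-prunesChildren-∷ ψ g ss) (grafts s) ⟩
      ∑ (λ g → isLeaf g * ψ ss + (∑ (λ p → ψ (p ∷ ss)) (prunes g) + ∑ (λ ps → ψ (g ∷ ps)) (prunesChildren ss))) (grafts s)
        ≡⟨ trans (∑-+ _ _ (grafts s)) (cong₂ _+_ (∑-*ʳ (ψ ss) isLeaf (grafts s)) (∑-+ _ _ (grafts s))) ⟩
      ∑ isLeaf (grafts s) * ψ ss
        + (∑ (λ g → ∑ (λ p → ψ (p ∷ ss)) (prunes g)) (grafts s) + ∑ (λ g → ∑ (λ ps → ψ (g ∷ ps)) (prunesChildren ss)) (grafts s))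
        ≡⟨ cong₂ (λ u v → u * ψ ss + v) (∑-isLeaf-grafts s)
                 (cong₂ _+_ (prunes-grafts-commute (λ p → ψ (p ∷ ss)) s) (∑-comm (λ g ps → ψ (g ∷ ps)) (grafts s) (prunesChildren ss))) ⟩
      (c₁ + p₁) + q₁
        ≡⟨ +-assoc c₁ p₁ q₁ ⟩
      c₁ + (p₁ + q₁) ∎

    grafted-tail : ∑ (λ gs → ∑ ψ (prunesChildren (s ∷ gs))) (graftsChildren ss) ≡ l + (p₂ + (c₂ + q₂))
    grafted-tail = begin
      ∑ (λ gs → ∑ ψ (prunesChildren (s ∷ gs))) (graftsChildren ss)
        ≡⟨ ∑-cong (∑-prunesChildren-∷ ψ s) (graftsChildren ss) ⟩
      ∑ (λ gs → isLeaf s * ψ gs + (∑ (λ p → ψ (p ∷ gs)) (prunes s) + ∑ (λ ps → ψ (s ∷ ps)) (prunesChildren gs))) (graftsChildren ss)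
        ≡⟨ trans (∑-+ _ _ (graftsChildren ss)) (cong₂ _+_ (∑-*ˡ (isLeaf s) ψ (graftsChildren ss)) (∑-+ _ _ (graftsChildren ss))) ⟩
      l + (∑ (λ gs → ∑ (λ p → ψ (p ∷ gs)) (prunes s)) (graftsChildren ss) + ∑ (λ gs → ∑ (λ ps → ψ (s ∷ ps)) (prunesChildren gs)) (graftsChildren ss))
        ≡⟨ cong (l +_) (cong₂ _+_ (∑-comm (λ gs p → ψ (p ∷ gs)) (graftsChildren ss) (prunes s))
                                  (prunesChildren-graftsChildren-commute (λ ps → ψ (s ∷ ps)) ss)) ⟩
      l + (p₂ + (c₂ + q₂)) ∎

    pruned-sum : ∑ (∑ ψ ∘ graftsChildren) (prunesChildren (s ∷ ss)) ≡ l + ((p₁ + p₂) + (q₁ + q₂))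
    pruned-sum = begin
      ∑ (∑ ψ ∘ graftsChildren) (prunesChildren (s ∷ ss))
        ≡⟨ ∑-prunesChildren-∷ (∑ ψ ∘ graftsChildren) s ss ⟩
      isLeaf s * ∑ ψ (graftsChildren ss)
        + (∑ (λ p → ∑ ψ (graftsChildren (p ∷ ss))) (prunes s) + ∑ (λ ps → ∑ ψ (graftsChildren (s ∷ ps))) (prunesChildren ss))
        ≡⟨ cong (l +_) (cong₂ _+_ (trans (∑-cong (λ p → ∑-graftsChildren-∷ ψ p ss) (prunes s)) (∑-+ _ _ (prunes s)))
                                  (trans (∑-cong (λ ps → ∑-graftsChildren-∷ ψ s ps) (prunesChildren ss)) (∑-+ _ _ (prunesChildren ss)))) ⟩
      l + ((p₁ + p₂) + (q₁ + q₂)) ∎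

prunes⊣grafts : ∀ t s → ∑ (λ g → #iso g s) (grafts t) ≡ ∑ (#iso t) (prunes s)
prunes⊣grafts t s = begin
  ∑ (λ g → #iso g s) (grafts t)   ≡⟨ ∑-cong (λ g → #iso-sym g s) (grafts t) ⟩
  ∑ (#iso s) (grafts t)           ≡⟨ grafts⊣prunes s t ⟩
  ∑ (λ p → #iso p t) (prunes s)   ≡⟨ ∑-cong (λ p → #iso-sym p t) (prunes s) ⟩
  ∑ (#iso t) (prunes s)           ∎
  where open ≡-Reasoning

#isos : List Tree → List Tree → ℕ
#isos xs ys = ∑ (λ x → ∑ (#iso x) ys) xs

#isos-grafts-prunes : ∀ t₁ t₂ →
  #isos (grafts t₁) (grafts t₂) ≡ size t₁ * #iso t₁ t₂ + #isos (prunes t₁) (prunes t₂)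
#isos-grafts-prunes t₁ t₂ = begin
  ∑ (λ g → ∑ (#iso g) (grafts t₂)) (grafts t₁)
    ≡⟨ ∑-cong (λ g → grafts⊣prunes g t₂) (grafts t₁) ⟩
  ∑ (λ g → ∑ (λ p → #iso p t₂) (prunes g)) (grafts t₁)
    ≡⟨ prunes-grafts-commute (λ p → #iso p t₂) t₁ ⟩
  size t₁ * #iso t₁ t₂ + ∑ (λ p → ∑ (λ g → #iso g t₂) (grafts p)) (prunes t₁)
    ≡⟨ cong (size t₁ * #iso t₁ t₂ +_) (∑-cong (λ p → prunes⊣grafts p t₂) (prunes t₁)) ⟩
  size t₁ * #iso t₁ t₂ + ∑ (λ p → ∑ (#iso p) (prunes t₂)) (prunes t₁) ∎
  where open ≡-Reasoning

module IsomorphismClasses {c ℓ} (K : Field c ℓ) (_≅?_ : Decidable _≅_) where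
  open Operators K _≅?_ using (countIso; classes; localSymmetry; |SG|; |SG|s)

  ≅-decSetoid : DecSetoid _ _
  ≅-decSetoid = record { isDecEquivalence = record { isEquivalence = ≅-isEquivalence ; _≟_ = _≅?_ } }

  classes-unique : ∀ ts → Unique (classes ts)
  classes-unique = deduplicate-! ≅-decSetoid

  ∈⇒∈≅-classes : ∀ {x ts} → x ∈ ts → x ∈≅ classes ts
  ∈⇒∈≅-classes = ∈-deduplicate⁺ ≅-setoid _≅?_ (λ y′≅y x≅y → ≅-trans x≅y (≅-sym y′≅y)) ∘ Any.map (λ { refl → ≅-refl })

  δ≅ : Tree → Tree → ℕ
  δ≅ x a with x ≅? a
  ... | yes _ = 1
  ... | no  _ = 0

  ≇⇒δ≅≡0 : ∀ {x a} → ¬ x ≅ a → δ≅ x a ≡ 0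
  ≇⇒δ≅≡0 {x} {a} x≇a with x ≅? a
  ... | yes x≅a = ⊥-elim (x≇a x≅a)
  ... | no  _   = refl

  countIso-∷ : ∀ a x L → countIso a (x ∷ L) ≡ δ≅ x a + countIso a L
  countIso-∷ a x L with x ≅? a
  ... | yes _ = refl
  ... | no  _ = refl

  countIso-∷-≅ : ∀ {x a} L → x ≅ a → countIso a (x ∷ L) ≡ suc (countIso a L)
  countIso-∷-≅ {x} {a} L x≅a with x ≅? a
  ... | yes _   = refl
  ... | no  x≇a = ⊥-elim (x≇a x≅a)

  countIso-∷-≇ : ∀ {x a} L → ¬ x ≅ a → countIso a (x ∷ L) ≡ countIso a L
  countIso-∷-≇ {x} {a} L x≇a with x ≅? a
  ... | yes x≅a = ⊥-elim (x≇a x≅a)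
  ... | no  _   = refl

  countIso≡∑δ≅ : ∀ a L → countIso a L ≡ ∑ (λ x → δ≅ x a) L
  countIso≡∑δ≅ a []      = refl
  countIso≡∑δ≅ a (x ∷ L) = trans (countIso-∷ a x L) (cong (δ≅ x a +_) (countIso≡∑δ≅ a L))

  countIso-cong : ∀ {a a′} → a ≅ a′ → ∀ L → countIso a L ≡ countIso a′ L
  countIso-cong a≅a′ []      = refl
  countIso-cong {a} {a′} a≅a′ (x ∷ L) with x ≅? a | x ≅? a′
  ... | yes _   | yes _    = cong suc (countIso-cong a≅a′ L)
  ... | no  _   | no  _    = countIso-cong a≅a′ L
  ... | yes x≅a | no  x≇a′ = ⊥-elim (x≇a′ (≅-trans x≅a a≅a′))
  ... | no  x≇a | yes x≅a′ = ⊥-elim (x≇a (≅-trans x≅a′ (≅-sym a≅a′)))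

  ≅⇒δ≅≡1 : ∀ {x a} → x ≅ a → δ≅ x a ≡ 1
  ≅⇒δ≅≡1 {x} {a} x≅a with x ≅? a
  ... | yes _   = refl
  ... | no  x≇a = ⊥-elim (x≇a x≅a)

  ∑-δ≅ : (g : Tree → ℕ) → (∀ {a b} → a ≅ b → g a ≡ g b) →
         ∀ {x C} → Unique C → x ∈≅ C → ∑ (λ a → δ≅ x a * g a) C ≡ g x
  ∑-δ≅ g g-cong {x} {a ∷ C} (a≇C ∷ _) (here x≅a) = begin
    δ≅ x a * g a + ∑ (λ b → δ≅ x b * g b) C
      ≡⟨ cong₂ _+_ (cong (_* g a) (≅⇒δ≅≡1 x≅a)) (∑-cong-All (All.map (λ x≇b → cong (_* g _) (≇⇒δ≅≡0 x≇b)) (≅-All-≇ x≅a a≇C))) ⟩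
    1 * g a + ∑ (λ _ → 0) C
      ≡⟨ cong₂ _+_ (*-identityˡ (g a)) (∑-zero C) ⟩
    g a + 0
      ≡⟨ trans (+-identityʳ (g a)) (g-cong (≅-sym x≅a)) ⟩
    g x ∎
    where open ≡-Reasoning
  ∑-δ≅ g g-cong {x} {a ∷ C} (a≇C ∷ C-unique) (there x∈C) =
    trans (cong (λ d → d * g a + ∑ (λ b → δ≅ x b * g b) C) (≇⇒δ≅≡0 (∈≅-All-≇ x∈C a≇C))) (∑-δ≅ g g-cong C-unique x∈C)

  ∑-classes : (g : Tree → ℕ) → (∀ {a b} → a ≅ b → g a ≡ g b) →
              ∀ L → ∑ (λ a → countIso a L * g a) (classes L) ≡ ∑ g L
  ∑-classes g g-cong L = begin
    ∑ (λ a → countIso a L * g a) (classes L)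
      ≡⟨ ∑-cong (λ a → trans (cong (_* g a) (countIso≡∑δ≅ a L)) (sym (∑-*ʳ (g a) (λ x → δ≅ x a) L))) (classes L) ⟩
    ∑ (λ a → ∑ (λ x → δ≅ x a * g a) L) (classes L)
      ≡⟨ ∑-comm (λ a x → δ≅ x a * g a) (classes L) L ⟩
    ∑ (λ x → ∑ (λ a → δ≅ x a * g a) (classes L)) L
      ≡⟨ ∑-cong-All (All.tabulate (λ x∈L → ∑-δ≅ g g-cong (classes-unique L) (∈⇒∈≅-classes x∈L))) ⟩
    ∑ g L ∎
    where open ≡-Reasoning

  ∑∑-classes : ∀ G₁ G₂ →
    ∑ (λ t → ∑ (λ s → countIso t G₁ * countIso s G₂ * #iso t s) (classes G₂)) (classes G₁) ≡ #isos G₁ G₂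
  ∑∑-classes G₁ G₂ = begin
    ∑ (λ t → ∑ (λ s → countIso t G₁ * countIso s G₂ * #iso t s) (classes G₂)) (classes G₁)
      ≡⟨ ∑-cong (λ t → trans (∑-cong (λ s → *-assoc (countIso t G₁) _ _) (classes G₂))
                             (∑-*ˡ (countIso t G₁) _ (classes G₂))) (classes G₁) ⟩
    ∑ (λ t → countIso t G₁ * ∑ (λ s → countIso s G₂ * #iso t s) (classes G₂)) (classes G₁)
      ≡⟨ ∑-cong (λ t → cong (countIso t G₁ *_) (∑-classes (#iso t) (#iso-congʳ t) G₂)) (classes G₁) ⟩
    ∑ (λ t → countIso t G₁ * ∑ (#iso t) G₂) (classes G₁)
      ≡⟨ ∑-classes (λ t → ∑ (#iso t) G₂) (λ t≅t′ → ∑-cong (#iso-congˡ t≅t′) G₂) G₁ ⟩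
    #isos G₁ G₂ ∎
    where open ≡-Reasoning

  -- localSymmetry multiplies over the classes with a where-bound function that cannot be named;
  -- abstracting the list of classes lets unification supply it as P.
  localSymmetry≡∏ : ∀ ts → localSymmetry ts ≡ ∏ (λ u → countIso u ts !) (classes ts)
  localSymmetry≡∏ ts with ∏-unique (λ u → countIso u ts !) _ refl (λ _ _ → refl) | classes ts
  ... | P≡∏ | C = P≡∏ C

  ∏suc-countIso : List Tree → ℕ
  ∏suc-countIso []       = 1
  ∏suc-countIso (t ∷ ts) = suc (countIso t ts) * ∏suc-countIso ts

  ∏-countIso-∷ : ∀ {x C} L → Unique C → x ∈≅ C →
                 ∏ (λ u → countIso u (x ∷ L) !) C ≡ suc (countIso x L) * ∏ (λ u → countIso u L !) C
  ∏-countIso-∷ {x} {a ∷ C} L (a≇C ∷ _) (here x≅a) = begin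
    countIso a (x ∷ L) ! * ∏ (λ u → countIso u (x ∷ L) !) C
      ≡⟨ cong₂ (λ m p → m ! * p) (trans (countIso-∷-≅ L x≅a) (cong suc (countIso-cong (≅-sym x≅a) L)))
                                 (∏-cong-All (All.map (λ x≇u → cong _! (countIso-∷-≇ L x≇u)) (≅-All-≇ x≅a a≇C))) ⟩
    suc (countIso x L) ! * ∏ (λ u → countIso u L !) C
      ≡⟨ *-assoc (suc (countIso x L)) (countIso x L !) _ ⟩
    suc (countIso x L) * (countIso x L ! * ∏ (λ u → countIso u L !) C)
      ≡⟨ cong (λ m → suc (countIso x L) * (m ! * ∏ (λ u → countIso u L !) C)) (countIso-cong x≅a L) ⟩
    suc (countIso x L) * (countIso a L ! * ∏ (λ u → countIso u L !) C) ∎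
    where open ≡-Reasoning
  ∏-countIso-∷ {x} {a ∷ C} L (a≇C ∷ C-unique) (there x∈C) =
    trans (cong₂ (λ m p → m ! * p) (countIso-∷-≇ L (∈≅-All-≇ x∈C a≇C)) (∏-countIso-∷ L C-unique x∈C))
          (*-CS.x∙yz≈y∙xz (countIso a L !) (suc (countIso x L)) _)

  ∏-countIso : ∀ {C} → Unique C → ∀ L → (∀ {x} → x ∈ L → x ∈≅ C) →
               ∏ (λ u → countIso u L !) C ≡ ∏suc-countIso L
  ∏-countIso {C} C-unique []      _     = ∏-const-1 C
  ∏-countIso     C-unique (x ∷ L) cover =
    trans (∏-countIso-∷ L C-unique (cover (here refl)))
          (cong (suc (countIso x L) *_) (∏-countIso C-unique L (cover ∘ there)))

  localSymmetry≡∏suc-countIso : ∀ ts → localSymmetry ts ≡ ∏suc-countIso ts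
  localSymmetry≡∏suc-countIso ts = trans (localSymmetry≡∏ ts) (∏-countIso (classes-unique ts) ts ∈⇒∈≅-classes)

  mutual
    #iso-self : ∀ t → #iso t t ≡ |SG| t
    #iso-self (node ts) =
      trans (#matchings-self ts) (cong (_* |SG|s ts) (sym (localSymmetry≡∏suc-countIso ts)))

    #matchings-self : ∀ ts → #matchings ts ts ≡ ∏suc-countIso ts * |SG|s ts
    #matchings-self []       = refl
    #matchings-self (t ∷ ts) = begin
      ∑picks Φ (t ∷ ts)
        ≡⟨ ∑picks-∷ Φ t ts ⟩
      Φ t ts + ∑picks (λ s rest → Φ s (t ∷ rest)) ts
        ≡⟨ cong (Φ t ts +_) (∑picks-proj₁ _ (λ s → δ≅ s t * Φ t ts) ts other-picks) ⟩
      Φ t ts + ∑ (λ s → δ≅ s t * Φ t ts) ts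
        ≡⟨ cong (Φ t ts +_) (trans (∑-*ʳ (Φ t ts) (λ s → δ≅ s t) ts) (cong (_* Φ t ts) (sym (countIso≡∑δ≅ t ts)))) ⟩
      suc (countIso t ts) * (#iso t t * #matchings ts ts)
        ≡⟨ cong₂ (λ m n → suc (countIso t ts) * (m * n)) (#iso-self t) (#matchings-self ts) ⟩
      suc (countIso t ts) * (|SG| t * (∏suc-countIso ts * |SG|s ts))
        ≡⟨ rearrange (suc (countIso t ts)) (|SG| t) (∏suc-countIso ts) (|SG|s ts) ⟩
      (suc (countIso t ts) * ∏suc-countIso ts) * (|SG| t * |SG|s ts) ∎
      where
      open ≡-Reasoning
      Φ : Tree → List Tree → ℕ
      Φ s rest = #iso t s * #matchings ts rest

      rearrange : ∀ a b c d → a * (b * (c * d)) ≡ (a * c) * (b * d)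
      rearrange = solve-∀

      other-picks : ∀ {s rest} → (s , rest) ∈ picks ts → Φ s (t ∷ rest) ≡ δ≅ s t * Φ t ts
      other-picks {s} {rest} s,rest∈picks with s ≅? t
      ... | yes s≅t = trans (cong₂ _*_ (#iso-congʳ t s≅t) (#iso-congʳ (node ts) t∷rest≅ts)) (sym (+-identityʳ _))
        where
        t∷rest≅ts : node (t ∷ rest) ≅ node ts
        t∷rest≅ts = ≅-trans (≅-∷ (≅-sym s≅t) ≅-refl) (↭⇒≅ (↭-sym (picks-↭ s,rest∈picks)))
      ... | no  s≇t = cong (_* #matchings ts (t ∷ rest)) (#iso-≇ (s≇t ∘ ≅-sym))

  #iso-≅ : ∀ {t s} → t ≅ s → #iso t s ≡ |SG| t
  #iso-≅ {t} t≅s = trans (#iso-congʳ t (≅-sym t≅s)) (#iso-self t)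

module InnerProduct {c ℓ} (K : Field c ℓ) (_≅?_ : Decidable _≅_) where
  open Operators K _≅?_
  open IsomorphismClasses K _≅?_ using (#iso-≅; ∑∑-classes)
  module K = Field K
  open K using (_≈_; _·_; 1#)
  open import Algebra.Properties.Semiring.Mult K.semiring using (×-homo-+; ×1-homo-*; ×-congˡ)
  open import Algebra.Properties.Group K.+-group using (//-rightDividesʳ)

  ⟪⟫≈#iso : ∀ t s → ⟪ t , s ⟫ ≈ (#iso t s · 1#)
  ⟪⟫≈#iso t s with t ≅? s
  ... | yes t≅s = ×-congˡ (sym (#iso-≅ t≅s))
  ... | no  t≇s = ×-congˡ (sym (#iso-≇ t≇s))

  ℕ-combination : (Tree → ℕ) → List Tree → Vec
  ℕ-combination f = map (λ t → (f t · 1# , t))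

  innerR-ℕ-combination : ∀ m (g : Tree → ℕ) t C →
    innerR (m · 1#) t (ℕ-combination g C) ≈ (∑ (λ s → m * g s * #iso t s) C · 1#)
  innerR-ℕ-combination m g t []      = K.refl
  innerR-ℕ-combination m g t (s ∷ C) = begin
    ((m · 1#) K.* (g s · 1#)) K.* ⟪ t , s ⟫ K.+ innerR (m · 1#) t (ℕ-combination g C)
      ≈⟨ K.+-cong (K.*-cong (K.sym (×1-homo-* m (g s))) (⟪⟫≈#iso t s)) (innerR-ℕ-combination m g t C) ⟩
    ((m * g s) · 1#) K.* (#iso t s · 1#) K.+ (∑ (λ s → m * g s * #iso t s) C · 1#)
      ≈⟨ K.+-cong (K.sym (×1-homo-* (m * g s) (#iso t s))) K.refl ⟩
    ((m * g s * #iso t s) · 1#) K.+ (∑ (λ s → m * g s * #iso t s) C · 1#)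
      ≈⟨ ×-homo-+ 1# (m * g s * #iso t s) _ ⟨
    (∑ (λ s → m * g s * #iso t s) (s ∷ C) · 1#) ∎
    where open ≈-Reasoning K.setoid

  ⟨⟩-ℕ-combination : ∀ (f g : Tree → ℕ) C₁ C₂ →
    ⟨ ℕ-combination f C₁ , ℕ-combination g C₂ ⟩ ≈ (∑ (λ t → ∑ (λ s → f t * g s * #iso t s) C₂) C₁ · 1#)
  ⟨⟩-ℕ-combination f g []       C₂ = K.refl
  ⟨⟩-ℕ-combination f g (t ∷ C₁) C₂ =
    K.trans (K.+-cong (innerR-ℕ-combination (f t) g t C₂) (⟨⟩-ℕ-combination f g C₁ C₂))
            (K.sym (×-homo-+ 1# (∑ (λ s → f t * g s * #iso t s) C₂) _))

  ⟨⟩-classes : ∀ G₁ G₂ →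
    ⟨ ℕ-combination (λ t → countIso t G₁) (classes G₁) , ℕ-combination (λ s → countIso s G₂) (classes G₂) ⟩
      ≈ (#isos G₁ G₂ · 1#)
  ⟨⟩-classes G₁ G₂ = K.trans (⟨⟩-ℕ-combination (λ t → countIso t G₁) (λ s → countIso s G₂) (classes G₁) (classes G₂))
                             (×-congˡ (∑∑-classes G₁ G₂))

  𝔓≡ℕ-combination : ∀ t → 𝔓 t ≡ ℕ-combination (λ t′ → countIso t′ (prunes t)) (classes (prunes t))
  𝔓≡ℕ-combination (node [])      = refl
  𝔓≡ℕ-combination (node (_ ∷ _)) = refl

  ⟨𝔑,𝔑⟩−⟨𝔓,𝔓⟩ : ∀ t₁ t₂ → (⟨ 𝔑 t₁ , 𝔑 t₂ ⟩ − ⟨ 𝔓 t₁ , 𝔓 t₂ ⟩) ≈ ((size t₁ * #iso t₁ t₂) · 1#)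
  ⟨𝔑,𝔑⟩−⟨𝔓,𝔓⟩ t₁ t₂ = begin
    ⟨ 𝔑 t₁ , 𝔑 t₂ ⟩ − ⟨ 𝔓 t₁ , 𝔓 t₂ ⟩
      ≈⟨ K.+-cong (⟨⟩-classes (grafts t₁) (grafts t₂))
                  (K.-‿cong (K.trans (K.reflexive (cong₂ ⟨_,_⟩ (𝔓≡ℕ-combination t₁) (𝔓≡ℕ-combination t₂)))
                                     (⟨⟩-classes (prunes t₁) (prunes t₂)))) ⟩
    (#isos (grafts t₁) (grafts t₂) · 1#) − (p · 1#)
      ≈⟨ K.+-cong (K.trans (×-congˡ (#isos-grafts-prunes t₁ t₂)) (×-homo-+ 1# (size t₁ * #iso t₁ t₂) p)) K.refl ⟩
    (((size t₁ * #iso t₁ t₂) · 1#) K.+ (p · 1#)) − (p · 1#)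
      ≈⟨ //-rightDividesʳ (p · 1#) ((size t₁ * #iso t₁ t₂) · 1#) ⟩
    ((size t₁ * #iso t₁ t₂) · 1#) ∎
    where
    open ≈-Reasoning K.setoid
    p = #isos (prunes t₁) (prunes t₂)

proposition2p4 : ∀ {c ℓ : Level} (K : Field c ℓ) → CharacteristicZero K →
    (_≅?_ : Decidable _≅_) → (t₁ t₂ : Tree) →
    let open Field K
        open Operators K _≅?_
    in (¬ (t₁ ≅ t₂) → (⟨ 𝔑 t₁ , 𝔑 t₂ ⟩ − ⟨ 𝔓 t₁ , 𝔓 t₂ ⟩) ≈ 0#)
       × (t₁ ≅ t₂ → (⟨ 𝔑 t₁ , 𝔑 t₂ ⟩ − ⟨ 𝔓 t₁ , 𝔓 t₂ ⟩) ≈ ((size t₁ ℕ.* |SG| t₁) · 1#))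
proposition2p4 K _ _≅?_ t₁ t₂ =
    (λ t₁≇t₂ → K.trans (⟨𝔑,𝔑⟩−⟨𝔓,𝔓⟩ t₁ t₂)
                       (×-congˡ (trans (cong (size t₁ *_) (#iso-≇ t₁≇t₂)) (*-zeroʳ (size t₁)))))
  , (λ t₁≅t₂ → K.trans (⟨𝔑,𝔑⟩−⟨𝔓,𝔓⟩ t₁ t₂) (×-congˡ (cong (size t₁ *_) (#iso-≅ t₁≅t₂))))
  where
  module K = Field K
  open IsomorphismClasses K _≅?_ using (#iso-≅)
  open InnerProduct K _≅?_ using (⟨𝔑,𝔑⟩−⟨𝔓,𝔓⟩)
  open import Algebra.Properties.Semiring.Mult K.semiring using (×-congˡ)
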